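{- Let $T$ be any extension of $\mathsf{PA}(\mathsf{K4})$ and let $X$ be any set of $\Sigma_1(\Box)$ sentences. Then for any $\mathcal{L}_A(\Box)$-formula $\varphi$, if $T+X\vdash\varphi$, then there exist $\sigma_0,\ldots,\sigma_{k-1}\in X$ such that $T\vdash \sigma_0\land\cdots\land\sigma_{k-1}\to\varphi$.
   Context: The language $\mathcal{L}_A(\Box)$ is the language of arithmetic $\{0,S,+,\times,\le,=\}$ plus a unary modal operator $\Box$. A theory is a set of sentences; derivations use modus ponens, generalization, and necessitation (from $\varphi$ infer $\Box\varphi$), the latter applicable to any derived formula, including ones depending on the added axioms $X$. $\mathsf{PA}_\Box$ is Peano arithmetic plus the first-order logical axioms for $\mathcal{L}_A(\Box)$-formulas (including universal instantiation for $\mathcal{L}_A$-terms) plus induction for all $\mathcal{L}_A(\Box)$-formulas. $\mathsf{PA}(\mathsf{K4})$ is $\mathsf{PA}_\Box$ plus the universal closures of all $\Box(\varphi\to\psi)\to(\Box\varphi\to\Box\psi)$ and all $\Box\varphi\to\Box\Box\varphi$. The class $\Sigma_1(\Box)$ is the smallest class of $\mathcal{L}_A(\Box)$-formulas containing all $\Sigma_1$ arithmetic formulas and all formulas $\Box\varphi$, and closed under $\land$, $\lor$, $\exists x$, and $\forall x<t$ for $\mathcal{L}_A$-terms $t$ not containing $x$. -}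

module Defs where

open import Data.Nat using (ℕ; zero; suc)
open import Data.Fin using (Fin; zero; suc)
open import Data.Sum using (_⊎_)
open import Data.List using (List; []; _∷_)

-- Syntax of L_A(□): well-scoped de Bruijn terms and formulas.
-- Tm n / Fm n : terms / formulas whose free variables are among
-- var 0 , … , var (n-1).  Sentences are elements of Fm 0.

infixr 5 _⇒_
infix  7 _≐_ _≼_

data Tm (n : ℕ) : Set where
  var   : Fin n → Tm n
  𝟎     : Tm n
  S     : Tm n → Tm n
  _⊕_   : Tm n → Tm n → Tm n
  _⊗_   : Tm n → Tm n → Tm n

data Fm (n : ℕ) : Set where
  _≐_ : Tm n → Tm n → Fm n
  _≼_ : Tm n → Tm n → Fm n
  ⊥'  : Fm n
  _⇒_ : Fm n → Fm n → Fm n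
  ∀'  : Fm (suc n) → Fm n
  □   : Fm n → Fm n

Sentence : Set
Sentence = Fm 0

¬' : ∀ {n} → Fm n → Fm n
¬' φ = φ ⇒ ⊥'

⊤' : ∀ {n} → Fm n
⊤' = ⊥' ⇒ ⊥'

infixr 6 _∧'_ _∨'_
_∧'_ : ∀ {n} → Fm n → Fm n → Fm n
φ ∧' ψ = ¬' (φ ⇒ ¬' ψ)

_∨'_ : ∀ {n} → Fm n → Fm n → Fm n
φ ∨' ψ = ¬' φ ⇒ ψ

infixr 4 _⇔_
_⇔_ : ∀ {n} → Fm n → Fm n → Fm n
φ ⇔ ψ = (φ ⇒ ψ) ∧' (ψ ⇒ φ)

∃' : ∀ {n} → Fm (suc n) → Fm n
∃' φ = ¬' (∀' (¬' φ))

Ren : ℕ → ℕ → Set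
Ren m n = Fin m → Fin n

liftR : ∀ {m n} → Ren m n → Ren (suc m) (suc n)
liftR ρ zero    = zero
liftR ρ (suc i) = suc (ρ i)

renT : ∀ {m n} → Ren m n → Tm m → Tm n
renT ρ (var i) = var (ρ i)
renT ρ 𝟎       = 𝟎
renT ρ (S t)   = S (renT ρ t)
renT ρ (s ⊕ t) = renT ρ s ⊕ renT ρ t
renT ρ (s ⊗ t) = renT ρ s ⊗ renT ρ t

renF : ∀ {m n} → Ren m n → Fm m → Fm n
renF ρ (s ≐ t) = renT ρ s ≐ renT ρ t
renF ρ (s ≼ t) = renT ρ s ≼ renT ρ t
renF ρ ⊥'      = ⊥'
renF ρ (φ ⇒ ψ) = renF ρ φ ⇒ renF ρ ψ
renF ρ (∀' φ)  = ∀' (renF (liftR ρ) φ)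
renF ρ (□ φ)   = □ (renF ρ φ)

wkT : ∀ {n} → Tm n → Tm (suc n)
wkT = renT suc

wkF : ∀ {n} → Fm n → Fm (suc n)
wkF = renF suc

weakenSentence : ∀ {n} → Sentence → Fm n
weakenSentence {n} = renF (λ ())

Sub : ℕ → ℕ → Set
Sub m n = Fin m → Tm n

liftS : ∀ {m n} → Sub m n → Sub (suc m) (suc n)
liftS σ zero    = var zero
liftS σ (suc i) = wkT (σ i)

subT : ∀ {m n} → Sub m n → Tm m → Tm n
subT σ (var i) = σ i
subT σ 𝟎       = 𝟎
subT σ (S t)   = S (subT σ t)
subT σ (s ⊕ t) = subT σ s ⊕ subT σ t
subT σ (s ⊗ t) = subT σ s ⊗ subT σ t

subF : ∀ {m n} → Sub m n → Fm m → Fm n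
subF σ (s ≐ t) = subT σ s ≐ subT σ t
subF σ (s ≼ t) = subT σ s ≼ subT σ t
subF σ ⊥'      = ⊥'
subF σ (φ ⇒ ψ) = subF σ φ ⇒ subF σ ψ
subF σ (∀' φ)  = ∀' (subF (liftS σ) φ)
subF σ (□ φ)   = □ (subF σ φ)

single : ∀ {n} → Tm n → Sub (suc n) n
single t zero    = t
single t (suc i) = var i

_[_] : ∀ {n} → Fm (suc n) → Tm n → Fm n
φ [ t ] = subF (single t) φ

close : ∀ {n} → Fm n → Sentence
close {zero}  φ = φ
close {suc n} φ = close {n} (∀' φ)

Theory : Set₁
Theory = Sentence → Set

_+ₜ_ : Theory → Theory → Theory
(T +ₜ X) σ = T σ ⊎ X σ

-- Hilbert-style derivations with the first-order logical axioms for
-- L_A(□)-formulas, and the rules MP, Gen and Nec (Nec applies to any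
-- derived formula, including ones depending on non-logical axioms).
infix 3 _⊢_
data _⊢_ (T : Theory) : ∀ {n} → Fm n → Set where
  ax     : ∀ {n} {σ : Sentence} → T σ → T ⊢ weakenSentence {n} σ
  ax-K   : ∀ {n} (φ ψ : Fm n) → T ⊢ φ ⇒ ψ ⇒ φ
  ax-S   : ∀ {n} (φ ψ χ : Fm n) → T ⊢ (φ ⇒ ψ ⇒ χ) ⇒ (φ ⇒ ψ) ⇒ φ ⇒ χ
  ax-DN  : ∀ {n} (φ : Fm n) → T ⊢ ¬' (¬' φ) ⇒ φ
  ax-inst : ∀ {n} (φ : Fm (suc n)) (t : Tm n) → T ⊢ ∀' φ ⇒ φ [ t ]
  ax-gen  : ∀ {n} (ψ : Fm n) (φ : Fm (suc n)) →
            T ⊢ ∀' (wkF ψ ⇒ φ) ⇒ ψ ⇒ ∀' φ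
  ax-refl : ∀ {n} (t : Tm n) → T ⊢ t ≐ t
  ax-leib : ∀ {n} (φ : Fm (suc n)) (s t : Tm n) →
            T ⊢ s ≐ t ⇒ φ [ s ] ⇒ φ [ t ]
  mp     : ∀ {n} {φ ψ : Fm n} → T ⊢ φ ⇒ ψ → T ⊢ φ → T ⊢ ψ
  gen    : ∀ {n} {φ : Fm (suc n)} → T ⊢ φ → T ⊢ ∀' φ
  nec    : ∀ {n} {φ : Fm n} → T ⊢ φ → T ⊢ □ φ

_<'_ : ∀ {n} → Tm n → Tm n → Fm n
s <' t = S s ≼ t

x₀ x₁ : ∀ {n} → Tm (suc (suc n))
x₀ = var zero
x₁ = var (suc zero)

data PA-basic : Sentence → Set where
  succ-ne-zero : PA-basic (∀' (¬' (S (var zero) ≐ 𝟎)))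
  succ-inj     : PA-basic (∀' (∀' (S x₁ ≐ S x₀ ⇒ x₁ ≐ x₀)))
  add-zero     : PA-basic (∀' (var zero ⊕ 𝟎 ≐ var zero))
  add-succ     : PA-basic (∀' (∀' (x₁ ⊕ S x₀ ≐ S (x₁ ⊕ x₀))))
  mul-zero     : PA-basic (∀' (var zero ⊗ 𝟎 ≐ 𝟎))
  mul-succ     : PA-basic (∀' (∀' (x₁ ⊗ S x₀ ≐ (x₁ ⊗ x₀) ⊕ x₁)))
  leq-def      : PA-basic (∀' (∀' ((x₁ ≼ x₀) ⇔
                   ∃' (var (suc (suc zero)) ⊕ var zero ≐ var (suc zero)))))

Ind : ∀ {n} → Fm (suc n) → Fm n
Ind φ = (φ [ 𝟎 ] ∧' ∀' (φ ⇒ subF (λ { zero → S (var zero) ; (suc i) → var (suc i) }) φ))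
        ⇒ ∀' φ

data PA-K4 : Sentence → Set where
  basic : ∀ {σ} → PA-basic σ → PA-K4 σ
  ind   : ∀ {n} (φ : Fm (suc n)) → PA-K4 (close (Ind φ))
  K     : ∀ {n} (φ ψ : Fm n) → PA-K4 (close (□ (φ ⇒ ψ) ⇒ □ φ ⇒ □ ψ))
  Four  : ∀ {n} (φ : Fm n) → PA-K4 (close (□ φ ⇒ □ (□ φ)))

Extends-PAK4 : Theory → Set
Extends-PAK4 T = ∀ {σ} → PA-K4 σ → T ⊢ σ

∀<' : ∀ {n} → Tm n → Fm (suc n) → Fm n
∀<' t φ = ∀' ((var zero <' wkT t) ⇒ φ)

-- Δ₀: atomic formulas, closed under ⇒, ⊥ (hence all Boolean
-- connectives) and bounded universal (hence bounded existential)
-- quantification; all quantifier-free in the arithmetic language.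
data Δ₀ : ∀ {n} → Fm n → Set where
  eq   : ∀ {n} (s t : Tm n) → Δ₀ (s ≐ t)
  leq  : ∀ {n} (s t : Tm n) → Δ₀ (s ≼ t)
  bot  : ∀ {n} → Δ₀ {n} ⊥'
  imp  : ∀ {n} {φ ψ : Fm n} → Δ₀ φ → Δ₀ ψ → Δ₀ (φ ⇒ ψ)
  ball : ∀ {n} (t : Tm n) {φ : Fm (suc n)} → Δ₀ φ → Δ₀ (∀<' t φ)

data Σ₁ : ∀ {n} → Fm n → Set where
  delta : ∀ {n} {φ : Fm n} → Δ₀ φ → Σ₁ φ
  ex    : ∀ {n} {φ : Fm (suc n)} → Σ₁ φ → Σ₁ (∃' φ)

data Σ₁□ : ∀ {n} → Fm n → Set where
  sigma : ∀ {n} {φ : Fm n} → Σ₁ φ → Σ₁□ φ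
  box   : ∀ {n} (φ : Fm n) → Σ₁□ (□ φ)
  and   : ∀ {n} {φ ψ : Fm n} → Σ₁□ φ → Σ₁□ ψ → Σ₁□ (φ ∧' ψ)
  or    : ∀ {n} {φ ψ : Fm n} → Σ₁□ φ → Σ₁□ ψ → Σ₁□ (φ ∨' ψ)
  ex    : ∀ {n} {φ : Fm (suc n)} → Σ₁□ φ → Σ₁□ (∃' φ)
  ball  : ∀ {n} (t : Tm n) {φ : Fm (suc n)} → Σ₁□ φ → Σ₁□ (∀<' t φ)

⋀ : ∀ {n} → List (Fm n) → Fm n
⋀ []           = ⊤'
⋀ (σ ∷ [])     = σ
⋀ (σ ∷ τ ∷ σs) = σ ∧' ⋀ (τ ∷ σs)

-- An axiom of X is its own premise, modus ponens
-- concatenates premise lists, and generalization is harmless because the premises are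
-- sentences.  The real case is necessitation: from T ⊢ σ → φ, with σ the conjunction of
-- the premises, K gives T ⊢ □σ → □φ, and σ → □σ is provable in PA(K4) because σ is
-- Σ₁(□).  This provable Σ₁(□)-completeness is proved by induction on the formula: Δ₀
-- atoms and their negations are decided by the order axioms and then boxed through
-- □(t ≐ t), boxes are handled by axiom 4, and a bounded quantifier ∀x<t commutes with □
-- by induction on t.
module Submission where

open import Defs
open import Data.Nat using (ℕ; zero; suc)
open import Data.Fin using (zero; suc)
open import Data.List using (List; []; _∷_; _++_; map)
open import Data.List.Properties using (map-++)
open import Data.List.Relation.Unary.All using (All; []; _∷_)
open import Data.List.Relation.Unary.All.Properties using (++⁺)
open import Data.Product using (Σ; _×_; _,_)
open import Data.Sum using (inj₁; inj₂)
open import Relation.Binary.PropositionalEquality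
  using (_≡_; refl; sym; trans; cong; cong₂; subst; subst₂; module ≡-Reasoning)

-- Substitution algebra

infix 4 _≗ₛ_
_≗ₛ_ : ∀ {m n} → Sub m n → Sub m n → Set
σ ≗ₛ τ = ∀ i → σ i ≡ τ i

infixr 9 _∘ₛ_
_∘ₛ_ : ∀ {m n k} → Sub n k → Sub m n → Sub m k
(σ ∘ₛ τ) i = subT σ (τ i)

ren⇒sub : ∀ {m n} → Ren m n → Sub m n
ren⇒sub ρ i = var (ρ i)

liftS-cong : ∀ {m n} {σ τ : Sub m n} → σ ≗ₛ τ → liftS σ ≗ₛ liftS τ
liftS-cong p zero    = refl
liftS-cong p (suc i) = cong wkT (p i)

subT-cong : ∀ {m n} {σ τ : Sub m n} → σ ≗ₛ τ → ∀ t → subT σ t ≡ subT τ t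
subT-cong p (var i) = p i
subT-cong p 𝟎       = refl
subT-cong p (S t)   = cong S (subT-cong p t)
subT-cong p (s ⊕ t) = cong₂ _⊕_ (subT-cong p s) (subT-cong p t)
subT-cong p (s ⊗ t) = cong₂ _⊗_ (subT-cong p s) (subT-cong p t)

subF-cong : ∀ {m n} {σ τ : Sub m n} → σ ≗ₛ τ → ∀ φ → subF σ φ ≡ subF τ φ
subF-cong p (s ≐ t) = cong₂ _≐_ (subT-cong p s) (subT-cong p t)
subF-cong p (s ≼ t) = cong₂ _≼_ (subT-cong p s) (subT-cong p t)
subF-cong p ⊥'      = refl
subF-cong p (φ ⇒ ψ) = cong₂ _⇒_ (subF-cong p φ) (subF-cong p ψ)
subF-cong p (∀' φ)  = cong ∀' (subF-cong (liftS-cong p) φ)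
subF-cong p (□ φ)   = cong □ (subF-cong p φ)

renT≡subT : ∀ {m n} (ρ : Ren m n) t → renT ρ t ≡ subT (ren⇒sub ρ) t
renT≡subT ρ (var i) = refl
renT≡subT ρ 𝟎       = refl
renT≡subT ρ (S t)   = cong S (renT≡subT ρ t)
renT≡subT ρ (s ⊕ t) = cong₂ _⊕_ (renT≡subT ρ s) (renT≡subT ρ t)
renT≡subT ρ (s ⊗ t) = cong₂ _⊗_ (renT≡subT ρ s) (renT≡subT ρ t)

ren⇒sub-liftR : ∀ {m n} (ρ : Ren m n) → ren⇒sub (liftR ρ) ≗ₛ liftS (ren⇒sub ρ)
ren⇒sub-liftR ρ zero    = refl
ren⇒sub-liftR ρ (suc i) = refl

renF≡subF : ∀ {m n} (ρ : Ren m n) φ → renF ρ φ ≡ subF (ren⇒sub ρ) φ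
renF≡subF ρ (s ≐ t) = cong₂ _≐_ (renT≡subT ρ s) (renT≡subT ρ t)
renF≡subF ρ (s ≼ t) = cong₂ _≼_ (renT≡subT ρ s) (renT≡subT ρ t)
renF≡subF ρ ⊥'      = refl
renF≡subF ρ (φ ⇒ ψ) = cong₂ _⇒_ (renF≡subF ρ φ) (renF≡subF ρ ψ)
renF≡subF ρ (∀' φ)  =
  cong ∀' (trans (renF≡subF (liftR ρ) φ) (subF-cong (ren⇒sub-liftR ρ) φ))
renF≡subF ρ (□ φ)   = cong □ (renF≡subF ρ φ)

subT-∘ₛ : ∀ {m n k} (σ : Sub n k) (τ : Sub m n) t → subT σ (subT τ t) ≡ subT (σ ∘ₛ τ) t
subT-∘ₛ σ τ (var i) = refl
subT-∘ₛ σ τ 𝟎       = refl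
subT-∘ₛ σ τ (S t)   = cong S (subT-∘ₛ σ τ t)
subT-∘ₛ σ τ (s ⊕ t) = cong₂ _⊕_ (subT-∘ₛ σ τ s) (subT-∘ₛ σ τ t)
subT-∘ₛ σ τ (s ⊗ t) = cong₂ _⊗_ (subT-∘ₛ σ τ s) (subT-∘ₛ σ τ t)

subT-renT : ∀ {m n k} (σ : Sub n k) (ρ : Ren m n) {τ : Sub m k} →
            (∀ i → σ (ρ i) ≡ τ i) → ∀ t → subT σ (renT ρ t) ≡ subT τ t
subT-renT σ ρ p t =
  trans (cong (subT σ) (renT≡subT ρ t)) (trans (subT-∘ₛ σ (ren⇒sub ρ) t) (subT-cong p t))

subT-liftS-wkT : ∀ {n k} (σ : Sub n k) t → subT (liftS σ) (wkT t) ≡ wkT (subT σ t)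
subT-liftS-wkT σ t = begin
  subT (liftS σ) (wkT t)         ≡⟨ subT-renT (liftS σ) suc (λ i → renT≡subT suc (σ i)) t ⟩
  subT (ren⇒sub suc ∘ₛ σ) t      ≡⟨ sym (subT-∘ₛ (ren⇒sub suc) σ t) ⟩
  subT (ren⇒sub suc) (subT σ t)  ≡⟨ sym (renT≡subT suc (subT σ t)) ⟩
  wkT (subT σ t)                 ∎
  where open ≡-Reasoning

liftS-∘ₛ : ∀ {m n k} (σ : Sub n k) (τ : Sub m n) → liftS σ ∘ₛ liftS τ ≗ₛ liftS (σ ∘ₛ τ)
liftS-∘ₛ σ τ zero    = refl
liftS-∘ₛ σ τ (suc i) = subT-liftS-wkT σ (τ i)

subF-∘ₛ : ∀ {m n k} (σ : Sub n k) (τ : Sub m n) φ → subF σ (subF τ φ) ≡ subF (σ ∘ₛ τ) φ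
subF-∘ₛ σ τ (s ≐ t) = cong₂ _≐_ (subT-∘ₛ σ τ s) (subT-∘ₛ σ τ t)
subF-∘ₛ σ τ (s ≼ t) = cong₂ _≼_ (subT-∘ₛ σ τ s) (subT-∘ₛ σ τ t)
subF-∘ₛ σ τ ⊥'      = refl
subF-∘ₛ σ τ (φ ⇒ ψ) = cong₂ _⇒_ (subF-∘ₛ σ τ φ) (subF-∘ₛ σ τ ψ)
subF-∘ₛ σ τ (∀' φ)  =
  cong ∀' (trans (subF-∘ₛ (liftS σ) (liftS τ) φ) (subF-cong (liftS-∘ₛ σ τ) φ))
subF-∘ₛ σ τ (□ φ)   = cong □ (subF-∘ₛ σ τ φ)

subF-renF : ∀ {m n k} (σ : Sub n k) (ρ : Ren m n) {τ : Sub m k} →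
            (∀ i → σ (ρ i) ≡ τ i) → ∀ φ → subF σ (renF ρ φ) ≡ subF τ φ
subF-renF σ ρ p φ =
  trans (cong (subF σ) (renF≡subF ρ φ)) (trans (subF-∘ₛ σ (ren⇒sub ρ) φ) (subF-cong p φ))

subT-var : ∀ {n} (t : Tm n) → subT var t ≡ t
subT-var (var i) = refl
subT-var 𝟎       = refl
subT-var (S t)   = cong S (subT-var t)
subT-var (s ⊕ t) = cong₂ _⊕_ (subT-var s) (subT-var t)
subT-var (s ⊗ t) = cong₂ _⊗_ (subT-var s) (subT-var t)

liftS-var : ∀ {n} → liftS {n} var ≗ₛ var
liftS-var zero    = refl
liftS-var (suc i) = refl

subF-var : ∀ {n} (φ : Fm n) → subF var φ ≡ φ
subF-var (s ≐ t) = cong₂ _≐_ (subT-var s) (subT-var t)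
subF-var (s ≼ t) = cong₂ _≼_ (subT-var s) (subT-var t)
subF-var ⊥'      = refl
subF-var (φ ⇒ ψ) = cong₂ _⇒_ (subF-var φ) (subF-var ψ)
subF-var (∀' φ)  = cong ∀' (trans (subF-cong liftS-var φ) (subF-var φ))
subF-var (□ φ)   = cong □ (subF-var φ)

subF-liftS-wkF : ∀ {n k} (σ : Sub n k) ψ → subF (liftS σ) (wkF ψ) ≡ wkF (subF σ ψ)
subF-liftS-wkF σ ψ = begin
  subF (liftS σ) (wkF ψ)         ≡⟨ subF-renF (liftS σ) suc (λ i → renT≡subT suc (σ i)) ψ ⟩
  subF (ren⇒sub suc ∘ₛ σ) ψ      ≡⟨ sym (subF-∘ₛ (ren⇒sub suc) σ ψ) ⟩
  subF (ren⇒sub suc) (subF σ ψ)  ≡⟨ sym (renF≡subF suc (subF σ ψ)) ⟩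
  wkF (subF σ ψ)                 ∎
  where open ≡-Reasoning

subT-single-wkT : ∀ {n} (u : Tm n) t → subT (single u) (wkT t) ≡ t
subT-single-wkT u t = trans (subT-renT (single u) suc (λ i → refl) t) (subT-var t)

subF-single : ∀ {m n} (σ : Sub m n) φ t → subF σ (φ [ t ]) ≡ subF (liftS σ) φ [ subT σ t ]
subF-single σ φ t = begin
  subF σ (φ [ t ])                        ≡⟨ subF-∘ₛ σ (single t) φ ⟩
  subF (σ ∘ₛ single t) φ                  ≡⟨ subF-cong commute φ ⟩
  subF (single (subT σ t) ∘ₛ liftS σ) φ   ≡⟨ sym (subF-∘ₛ (single (subT σ t)) (liftS σ) φ) ⟩
  subF (liftS σ) φ [ subT σ t ]           ∎
  where
  open ≡-Reasoning
  commute : σ ∘ₛ single t ≗ₛ single (subT σ t) ∘ₛ liftS σ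
  commute zero    = refl
  commute (suc i) = sym (subT-single-wkT (subT σ t) (σ i))

subF-weakenSentence : ∀ {m n} (σ : Sub m n) (φ : Sentence) →
                      subF σ (weakenSentence {m} φ) ≡ weakenSentence {n} φ
subF-weakenSentence σ φ =
  trans (subF-renF σ (λ ()) (λ ()) φ) (sym (renF≡subF (λ ()) φ))

renF-weakenSentence : ∀ {m n} (ρ : Ren m n) (φ : Sentence) →
                      renF ρ (weakenSentence {m} φ) ≡ weakenSentence {n} φ
renF-weakenSentence ρ φ = trans (renF≡subF ρ _) (subF-weakenSentence _ φ)

-- The body of wkF (∀' φ) is renF (liftR suc) φ.
liftR-suc-[var₀] : ∀ {n} (φ : Fm (suc n)) → renF (liftR suc) φ [ var zero ] ≡ φ
liftR-suc-[var₀] φ =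
  trans (subF-renF _ (liftR suc) {var} (λ { zero → refl ; (suc i) → refl }) φ) (subF-var φ)

module Derivations (T : Theory) where

  private variable
    n : ℕ
    Γ : List (Fm n)
    φ ψ χ : Fm n

  ⊢-subst : ∀ {m n} (σ : Sub m n) {φ : Fm m} → T ⊢ φ → T ⊢ subF σ φ
  ⊢-subst σ (ax {σ = s} p)  = subst (T ⊢_) (sym (subF-weakenSentence σ s)) (ax p)
  ⊢-subst σ (ax-K φ ψ)      = ax-K _ _
  ⊢-subst σ (ax-S φ ψ χ)    = ax-S _ _ _
  ⊢-subst σ (ax-DN φ)       = ax-DN _
  ⊢-subst σ (ax-inst φ t)   =
    subst (λ θ → T ⊢ ∀' (subF (liftS σ) φ) ⇒ θ) (sym (subF-single σ φ t)) (ax-inst _ _)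
  ⊢-subst σ (ax-gen ψ φ)    =
    subst (λ θ → T ⊢ ∀' (θ ⇒ subF (liftS σ) φ) ⇒ subF σ ψ ⇒ ∀' (subF (liftS σ) φ))
          (sym (subF-liftS-wkF σ ψ)) (ax-gen _ _)
  ⊢-subst σ (ax-refl t)     = ax-refl _
  ⊢-subst σ (ax-leib φ s t) =
    subst₂ (λ θ ξ → T ⊢ subT σ s ≐ subT σ t ⇒ θ ⇒ ξ)
           (sym (subF-single σ φ s)) (sym (subF-single σ φ t)) (ax-leib _ _ _)
  ⊢-subst σ (mp d e)        = mp (⊢-subst σ d) (⊢-subst σ e)
  ⊢-subst σ (gen d)         = gen (⊢-subst (liftS σ) d)
  ⊢-subst σ (nec d)         = nec (⊢-subst σ d)

  ⊢-rename : ∀ {m n} (ρ : Ren m n) {φ : Fm m} → T ⊢ φ → T ⊢ renF ρ φ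
  ⊢-rename ρ {φ} d = subst (T ⊢_) (sym (renF≡subF ρ φ)) (⊢-subst _ d)

  ∀'-elim : ∀ {n} {φ : Fm (suc n)} → T ⊢ ∀' φ → T ⊢ φ
  ∀'-elim {φ = φ} d =
    subst (T ⊢_) (liftR-suc-[var₀] φ) (mp (ax-inst _ (var zero)) (⊢-rename suc d))

  ∀'-elim⇒ : ∀ {n} (φ : Fm (suc n)) → T ⊢ wkF (∀' φ) ⇒ φ
  ∀'-elim⇒ φ = subst (λ θ → T ⊢ wkF (∀' φ) ⇒ θ) (liftR-suc-[var₀] φ) (ax-inst _ (var zero))

  close-elim : ∀ {n} {φ : Fm n} → T ⊢ close φ → T ⊢ φ
  close-elim {zero}  d = d
  close-elim {suc n} d = ∀'-elim (close-elim {n} d)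

  -- Hypotheses are combined by modus ponens only (no Gen or Nec), which is what makes
  -- the deduction theorem `lam` hold.
  infix 4 _∋_
  data _∋_ {n} : List (Fm n) → Fm n → Set where
    here  : ∀ {φ Γ} → (φ ∷ Γ) ∋ φ
    there : ∀ {φ ψ Γ} → Γ ∋ φ → (ψ ∷ Γ) ∋ φ

  infix  3 _⊩_
  infixl 5 _·_
  data _⊩_ {n} (Γ : List (Fm n)) : Fm n → Set where
    hyp : ∀ {φ} → Γ ∋ φ → Γ ⊩ φ
    thm : ∀ {φ} → T ⊢ φ → Γ ⊩ φ
    _·_ : ∀ {φ ψ} → Γ ⊩ φ ⇒ ψ → Γ ⊩ φ → Γ ⊩ ψ

  ⇒-refl : (φ : Fm n) → T ⊢ φ ⇒ φ
  ⇒-refl φ = mp (mp (ax-S φ (φ ⇒ φ) φ) (ax-K φ (φ ⇒ φ))) (ax-K φ φ)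

  lam : (φ ∷ Γ) ⊩ ψ → Γ ⊩ φ ⇒ ψ
  lam (hyp here)      = thm (⇒-refl _)
  lam (hyp (there p)) = thm (ax-K _ _) · hyp p
  lam (thm d)         = thm (ax-K _ _) · thm d
  lam (f · a)         = thm (ax-S _ _ _) · lam f · lam a

  derive : [] ⊩ φ → T ⊢ φ
  derive (hyp ())
  derive (thm d) = d
  derive (f · a) = mp (derive f) (derive a)

  weaken : Γ ⊩ ψ → (φ ∷ Γ) ⊩ ψ
  weaken (hyp p) = hyp (there p)
  weaken (thm d) = thm d
  weaken (f · a) = weaken f · weaken a

  h₀ : (φ ∷ Γ) ⊩ φ
  h₀ = hyp here
  h₁ : (ψ ∷ φ ∷ Γ) ⊩ φ
  h₁ = hyp (there here)
  h₂ : (χ ∷ ψ ∷ φ ∷ Γ) ⊩ φ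
  h₂ = hyp (there (there here))

  _∘⇒_ : T ⊢ ψ ⇒ χ → T ⊢ φ ⇒ ψ → T ⊢ φ ⇒ χ
  f ∘⇒ g = derive (lam (thm f · (thm g · h₀)))

  by-contradiction : (¬' φ ∷ Γ) ⊩ ⊥' → Γ ⊩ φ
  by-contradiction p = thm (ax-DN _) · lam p

  ⊥-elim : Γ ⊩ ⊥' → Γ ⊩ φ
  ⊥-elim p = by-contradiction (weaken p)

  contradiction : Γ ⊩ ¬' φ → Γ ⊩ φ → Γ ⊩ ψ
  contradiction p q = ⊥-elim (p · q)

  ∧-intro : Γ ⊩ φ → Γ ⊩ ψ → Γ ⊩ φ ∧' ψ
  ∧-intro a b = lam (h₀ · weaken a · weaken b)

  ∧-elimˡ : Γ ⊩ φ ∧' ψ → Γ ⊩ φ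
  ∧-elimˡ p = by-contradiction (weaken p · lam (contradiction h₁ h₀))

  ∧-elimʳ : Γ ⊩ φ ∧' ψ → Γ ⊩ ψ
  ∧-elimʳ p = by-contradiction (weaken p · lam (lam (h₂ · h₀)))

  ∨-introˡ : Γ ⊩ φ → Γ ⊩ φ ∨' ψ
  ∨-introˡ a = lam (contradiction h₀ (weaken a))

  ∨-introʳ : Γ ⊩ ψ → Γ ⊩ φ ∨' ψ
  ∨-introʳ b = lam (weaken b)

  ∨-elim : Γ ⊩ φ ∨' ψ → (φ ∷ Γ) ⊩ χ → (ψ ∷ Γ) ⊩ χ → Γ ⊩ χ
  ∨-elim p f g =
    by-contradiction (h₀ · (weaken (lam g) · (weaken p · lam (h₁ · (weaken (weaken (lam f)) · h₀)))))

  by-cases : (φ ∷ Γ) ⊩ χ → (¬' φ ∷ Γ) ⊩ χ → Γ ⊩ χ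
  by-cases {φ = φ} f g = ∨-elim {φ = ¬' φ} {ψ = φ} (thm (ax-DN φ)) g f

  ∀'-inst : {φ : Fm (suc n)} (t : Tm n) → Γ ⊩ ∀' φ → Γ ⊩ φ [ t ]
  ∀'-inst {φ = φ} t p = thm (ax-inst φ t) · p

  ∃'-intro : {φ : Fm (suc n)} (t : Tm n) → Γ ⊩ φ [ t ] → Γ ⊩ ∃' φ
  ∃'-intro {φ = φ} t p = lam (thm (ax-inst (¬' φ) t) · h₀ · weaken p)

  ∀'-intro⇒ : {ψ : Fm (suc n)} → T ⊢ wkF φ ⇒ ψ → T ⊢ φ ⇒ ∀' ψ
  ∀'-intro⇒ d = mp (ax-gen _ _) (gen d)

  ∀'-mono : {φ ψ : Fm (suc n)} → T ⊢ φ ⇒ ψ → T ⊢ ∀' φ ⇒ ∀' ψ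
  ∀'-mono {φ = φ} d = ∀'-intro⇒ (d ∘⇒ ∀'-elim⇒ φ)

  ∃'-intro⇒ : (φ : Fm (suc n)) → T ⊢ φ ⇒ wkF (∃' φ)
  ∃'-intro⇒ φ = derive (lam (lam (thm (∀'-elim⇒ (¬' φ)) · h₀ · h₁)))

  ∃'-elim⇒ : {φ : Fm (suc n)} → T ⊢ φ ⇒ wkF χ → T ⊢ ∃' φ ⇒ χ
  ∃'-elim⇒ {χ = χ} {φ = φ} d =
    derive (lam (by-contradiction (h₁ · (thm (∀'-intro⇒ contrapositive) · h₀))))
    where
    contrapositive : T ⊢ wkF (¬' χ) ⇒ ¬' φ
    contrapositive = derive (lam (lam (h₁ · (thm d · h₀))))

-- Arithmetic in extensions of PA(K4)

v₀ : ∀ {n} → Tm (suc n)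
v₀ = var zero
v₁ : ∀ {n} → Tm (suc (suc n))
v₁ = var (suc zero)
v₂ : ∀ {n} → Tm (suc (suc (suc n)))
v₂ = var (suc (suc zero))
v₃ : ∀ {n} → Tm (suc (suc (suc (suc n))))
v₃ = var (suc (suc (suc zero)))

sub₁ : ∀ {n} → Tm n → Sub 1 n
sub₁ a zero = a

sub₂ : ∀ {n} → Tm n → Tm n → Sub 2 n
sub₂ a b zero       = a
sub₂ a b (suc zero) = b

sub₃ : ∀ {n} → Tm n → Tm n → Tm n → Sub 3 n
sub₃ a b c zero             = a
sub₃ a b c (suc zero)       = b
sub₃ a b c (suc (suc zero)) = c

succ₀ : ∀ {n} → Sub (suc n) (suc n)
succ₀ zero    = S (var zero)
succ₀ (suc i) = var (suc i)

-- Facts about terms are proved for variables (in a `generic` form) and instantiated by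
-- ⊢-subst: instantiating a formula containing abstract terms would only be equal, not
-- definitionally equal, to the intended instance.
module PA-K4-Reasoning (T : Theory) (T⊇PAK4 : Extends-PAK4 T) where
  open Derivations T

  private variable
    n : ℕ
    Γ : List (Fm n)
    a b c s t : Tm n

  infix 3 ⊢[_]_
  ⊢[_]_ : (n : ℕ) → Fm n → Set
  ⊢[ n ] φ = T ⊢ φ

  -- Ind φ substitutes x ↦ S x by a pattern lambda of its own, which agrees with succ₀
  -- only pointwise.
  induction : ∀ {k} (φ : Fm (suc k)) → T ⊢ φ [ 𝟎 ] → T ⊢ φ ⇒ subF succ₀ φ → T ⊢ φ
  induction φ base step =
    ∀'-elim (mp (close-elim (T⊇PAK4 (ind φ))) (derive (∧-intro (thm base) (thm (gen step′)))))
    where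
    succ₀≗ : succ₀ ≗ₛ _
    succ₀≗ zero    = refl
    succ₀≗ (suc i) = refl
    step′ : T ⊢ φ ⇒ subF _ φ
    step′ = subst (λ θ → T ⊢ φ ⇒ θ) (subF-cong succ₀≗ φ) step

  □-distrib : ∀ {n} (φ ψ : Fm n) → T ⊢ □ (φ ⇒ ψ) ⇒ □ φ ⇒ □ ψ
  □-distrib φ ψ = close-elim (T⊇PAK4 (K φ ψ))

  □-4 : ∀ {n} (φ : Fm n) → T ⊢ □ φ ⇒ □ (□ φ)
  □-4 φ = close-elim (T⊇PAK4 (Four φ))

  □-mono : ∀ {n} {φ ψ : Fm n} → T ⊢ φ ⇒ ψ → T ⊢ □ φ ⇒ □ ψ
  □-mono d = mp (□-distrib _ _) (nec d)

  □-mono₂ : ∀ {n} {φ ψ χ : Fm n} → T ⊢ φ ⇒ ψ ⇒ χ → T ⊢ □ φ ⇒ □ ψ ⇒ □ χ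
  □-mono₂ {ψ = ψ} {χ} d = derive (lam (lam (thm (□-distrib ψ χ) · (thm (□-mono d) · h₁) · h₀)))

  ≐-refl : Γ ⊩ a ≐ a
  ≐-refl = thm (ax-refl _)

  ≐-subst : (θ : Fm (suc n)) → Γ ⊩ s ≐ t → Γ ⊩ θ [ s ] → Γ ⊩ θ [ t ]
  ≐-subst {s = s} {t = t} θ p q = thm (ax-leib θ s t) · p · q

  ≐-sym : Γ ⊩ a ≐ b → Γ ⊩ b ≐ a
  ≐-sym {a = a} {b = b} p = thm (⊢-subst (sub₂ a b) generic) · p
    where
    generic : ⊢[ 2 ] v₀ ≐ v₁ ⇒ v₁ ≐ v₀
    generic = derive (lam (≐-subst (v₀ ≐ v₁) h₀ ≐-refl))

  ≐-trans : Γ ⊩ a ≐ b → Γ ⊩ b ≐ c → Γ ⊩ a ≐ c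
  ≐-trans {a = a} {b = b} {c = c} p q = thm (⊢-subst (sub₃ a b c) generic) · p · q
    where
    generic : ⊢[ 3 ] v₀ ≐ v₁ ⇒ v₁ ≐ v₂ ⇒ v₀ ≐ v₂
    generic = derive (lam (lam (≐-subst (v₁ ≐ v₀) h₀ h₁)))

  S-cong : Γ ⊩ a ≐ b → Γ ⊩ S a ≐ S b
  S-cong {a = a} {b = b} p = thm (⊢-subst (sub₂ a b) generic) · p
    where
    generic : ⊢[ 2 ] v₀ ≐ v₁ ⇒ S v₀ ≐ S v₁
    generic = derive (lam (≐-subst (S v₁ ≐ S v₀) h₀ ≐-refl))

  ⊕-congʳ : (c : Tm n) → Γ ⊩ a ≐ b → Γ ⊩ a ⊕ c ≐ b ⊕ c
  ⊕-congʳ {a = a} {b = b} c p = thm (⊢-subst (sub₃ a b c) generic) · p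
    where
    generic : ⊢[ 3 ] v₀ ≐ v₁ ⇒ v₀ ⊕ v₂ ≐ v₁ ⊕ v₂
    generic = derive (lam (≐-subst (v₁ ⊕ v₃ ≐ v₀ ⊕ v₃) h₀ ≐-refl))

  ⊕-congˡ : (c : Tm n) → Γ ⊩ a ≐ b → Γ ⊩ c ⊕ a ≐ c ⊕ b
  ⊕-congˡ {a = a} {b = b} c p = thm (⊢-subst (sub₃ a b c) generic) · p
    where
    generic : ⊢[ 3 ] v₀ ≐ v₁ ⇒ v₂ ⊕ v₀ ≐ v₂ ⊕ v₁
    generic = derive (lam (≐-subst (v₃ ⊕ v₁ ≐ v₃ ⊕ v₀) h₀ ≐-refl))

  ⊕-identityʳ : ∀ {n} (a : Tm n) → T ⊢ a ⊕ 𝟎 ≐ a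
  ⊕-identityʳ a = ⊢-subst (sub₁ a) (∀'-elim (T⊇PAK4 (basic add-zero)))

  ⊕-suc : ∀ {n} (a b : Tm n) → T ⊢ a ⊕ S b ≐ S (a ⊕ b)
  ⊕-suc a b = ⊢-subst (sub₂ b a) (∀'-elim (∀'-elim (T⊇PAK4 (basic add-succ))))

  S≢𝟎 : ∀ {n} (a : Tm n) → T ⊢ ¬' (S a ≐ 𝟎)
  S≢𝟎 a = ⊢-subst (sub₁ a) (∀'-elim (T⊇PAK4 (basic succ-ne-zero)))

  S-injective : ∀ {n} (a b : Tm n) → T ⊢ S a ≐ S b ⇒ a ≐ b
  S-injective a b = ⊢-subst (sub₂ b a) (∀'-elim (∀'-elim (T⊇PAK4 (basic succ-inj))))

  ≼-def : ∀ {n} (a b : Tm n) → T ⊢ (a ≼ b) ⇔ ∃' (wkT a ⊕ v₀ ≐ wkT b)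
  ≼-def a b = ⊢-subst (sub₂ b a) (∀'-elim (∀'-elim (T⊇PAK4 (basic leq-def))))

  ≼⇒∃ : ∀ {n} (a b : Tm n) → T ⊢ (a ≼ b) ⇒ ∃' (wkT a ⊕ v₀ ≐ wkT b)
  ≼⇒∃ a b = derive (∧-elimˡ (thm (≼-def a b)))

  ≼-intro : ∀ {n} (a b c : Tm n) → T ⊢ a ⊕ b ≐ c ⇒ a ≼ c
  ≼-intro a b c = ⊢-subst (sub₃ a b c) generic
    where
    generic : ⊢[ 3 ] v₀ ⊕ v₁ ≐ v₂ ⇒ v₀ ≼ v₂
    generic = derive (lam (thm (derive (∧-elimʳ (thm (≼-def v₀ v₂)))) · ∃'-intro v₁ h₀))

  suc-⊕ : ∀ {n} (a b : Tm n) → T ⊢ S a ⊕ b ≐ S (a ⊕ b)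
  suc-⊕ a b = ⊢-subst (sub₂ b a) generic
    where
    generic : ⊢[ 2 ] S v₁ ⊕ v₀ ≐ S (v₁ ⊕ v₀)
    generic = induction _
      (derive (≐-trans (thm (⊕-identityʳ (S v₀))) (≐-sym (S-cong (thm (⊕-identityʳ v₀))))))
      (derive (lam (≐-trans (thm (⊕-suc (S v₁) v₀))
                   (≐-trans (S-cong h₀) (≐-sym (S-cong (thm (⊕-suc v₁ v₀))))))))

  ⊕-identityˡ : ∀ {n} (a : Tm n) → T ⊢ 𝟎 ⊕ a ≐ a
  ⊕-identityˡ a = ⊢-subst (sub₁ a) generic
    where
    generic : ⊢[ 1 ] 𝟎 ⊕ v₀ ≐ v₀
    generic = induction _ (⊕-identityʳ 𝟎) (derive (lam (≐-trans (thm (⊕-suc 𝟎 v₀)) (S-cong h₀))))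

  ⊕-assoc : ∀ {n} (a b c : Tm n) → T ⊢ (a ⊕ b) ⊕ c ≐ a ⊕ (b ⊕ c)
  ⊕-assoc a b c = ⊢-subst (sub₃ c b a) generic
    where
    generic : ⊢[ 3 ] (v₂ ⊕ v₁) ⊕ v₀ ≐ v₂ ⊕ (v₁ ⊕ v₀)
    generic = induction _
      (derive (≐-trans (thm (⊕-identityʳ (v₁ ⊕ v₀))) (⊕-congˡ v₁ (≐-sym (thm (⊕-identityʳ v₀))))))
      (derive (lam (≐-trans (thm (⊕-suc (v₂ ⊕ v₁) v₀)) (≐-trans (S-cong h₀)
         (≐-trans (≐-sym (thm (⊕-suc v₂ (v₁ ⊕ v₀)))) (⊕-congˡ v₂ (≐-sym (thm (⊕-suc v₁ v₀)))))))))

  zero∨suc : ⊢[ 1 ] (v₀ ≐ 𝟎) ∨' ∃' (v₁ ≐ S v₀)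
  zero∨suc = induction _ (derive (∨-introˡ ≐-refl)) (derive (lam (∨-introʳ (∃'-intro v₀ ≐-refl))))

  S⊕≢ : ∀ {n} (a b : Tm n) → T ⊢ ¬' (S a ⊕ b ≐ a)
  S⊕≢ a b = ⊢-subst (sub₂ a b) generic
    where
    generic : ⊢[ 2 ] ¬' (S v₀ ⊕ v₁ ≐ v₀)
    generic = induction _
      (derive (lam (thm (S≢𝟎 (𝟎 ⊕ v₀)) · ≐-trans (≐-sym (thm (suc-⊕ 𝟎 v₀))) h₀)))
      (derive (lam (lam (h₁ · (thm (S-injective (S v₀ ⊕ v₁) v₀)
                             · ≐-trans (≐-sym (thm (suc-⊕ (S v₀) v₁))) h₀)))))

  S≰𝟎 : ∀ {n} (a : Tm n) → T ⊢ ¬' (S a ≼ 𝟎)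
  S≰𝟎 a = ⊢-subst (sub₁ a) generic
    where
    generic : ⊢[ 1 ] ¬' (S v₀ ≼ 𝟎)
    generic = ∃'-elim⇒ (derive (lam (thm (S≢𝟎 (v₁ ⊕ v₀)) · ≐-trans (≐-sym (thm (suc-⊕ v₁ v₀))) h₀)))
              ∘⇒ ≼⇒∃ (S v₀) 𝟎

  ≼-refl : ∀ {n} (a : Tm n) → T ⊢ a ≼ a
  ≼-refl a = mp (≼-intro a 𝟎 a) (⊕-identityʳ a)

  ≼-step : ∀ {n} (a b : Tm n) → T ⊢ (a ≼ b) ⇒ (a ≼ S b)
  ≼-step a b = ⊢-subst (sub₂ a b) generic
    where
    generic : ⊢[ 2 ] (v₀ ≼ v₁) ⇒ (v₀ ≼ S v₁)
    generic = ∃'-elim⇒ (derive (lam (thm (≼-intro v₁ (S v₀) (S v₂))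
                                     · ≐-trans (thm (⊕-suc v₁ v₀)) (S-cong h₀))))
              ∘⇒ ≼⇒∃ v₀ v₁

  ≼⇒<∨≐ : ∀ {n} (a b : Tm n) → T ⊢ (a ≼ b) ⇒ (S a ≼ b) ∨' (a ≐ b)
  ≼⇒<∨≐ a b = ⊢-subst (sub₂ a b) generic
    where
    -- a + d = b splits on d = 0 or d = S e
    positive : ⊢[ 4 ] (v₁ ≐ S v₀) ⇒ (v₂ ⊕ v₁ ≐ v₃)
               ⇒ (S v₂ ≼ v₃) ∨' (v₂ ≐ v₃)
    positive = derive (lam (lam (∨-introˡ (thm (≼-intro (S v₂) v₀ _) ·
      ≐-trans (thm (suc-⊕ v₂ v₀))
        (≐-trans (≐-sym (thm (⊕-suc v₂ v₀))) (≐-trans (⊕-congˡ v₂ (≐-sym h₁)) h₀))))))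
    witness : ⊢[ 3 ] v₁ ⊕ v₀ ≐ v₂ ⇒ (S v₁ ≼ v₂) ∨' (v₁ ≐ v₂)
    witness = derive (lam (∨-elim (thm (⊢-subst (sub₁ v₀) zero∨suc))
      (∨-introʳ (≐-trans (≐-sym (thm (⊕-identityʳ v₁))) (≐-trans (⊕-congˡ v₁ (≐-sym h₀)) h₁)))
      (thm (∃'-elim⇒ positive) · h₀ · h₁)))
    generic : ⊢[ 2 ] (v₀ ≼ v₁) ⇒ (S v₀ ≼ v₁) ∨' (v₀ ≐ v₁)
    generic = ∃'-elim⇒ witness ∘⇒ ≼⇒∃ v₀ v₁

  S≼S⇒<∨≐ : ∀ {n} (a b : Tm n) → T ⊢ (S a ≼ S b) ⇒ (S a ≼ b) ∨' (a ≐ b)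
  S≼S⇒<∨≐ a b = ≼⇒<∨≐ a b ∘⇒ ⊢-subst (sub₂ a b) generic
    where
    generic : ⊢[ 2 ] (S v₀ ≼ S v₁) ⇒ (v₀ ≼ v₁)
    generic = ∃'-elim⇒ (derive (lam (thm (≼-intro v₁ v₀ v₂)
                · (thm (S-injective (v₁ ⊕ v₀) v₂) · ≐-trans (≐-sym (thm (suc-⊕ v₁ v₀))) h₀))))
              ∘⇒ ≼⇒∃ (S v₀) (S v₁)

  ≼-total : ∀ {n} (a b : Tm n) → T ⊢ (a ≼ b) ∨' (S b ≼ a)
  ≼-total a b = ⊢-subst (sub₂ a b) generic
    where
    generic : ⊢[ 2 ] (v₀ ≼ v₁) ∨' (S v₁ ≼ v₀)
    generic = induction _ (derive (∨-introˡ (thm (≼-intro 𝟎 v₀ v₀) · thm (⊕-identityˡ v₀))))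
      (derive (lam (∨-elim h₀
        (∨-elim (thm (≼⇒<∨≐ v₀ v₁) · h₀) (∨-introˡ h₀)
          (∨-introʳ (≐-subst (S v₂ ≼ S v₀) (≐-sym h₀) (thm (≼-refl (S v₁))))))
        (∨-introʳ (thm (≼-step (S v₁) v₀) · h₀)))))

  <⇒≱ : ∀ {n} (a b : Tm n) → T ⊢ (S b ≼ a) ⇒ ¬' (a ≼ b)
  <⇒≱ a b = ⊢-subst (sub₂ a b) generic
    where
    -- b + 1 + d = a and a + e = b give b + 1 + (d + e) = b
    cycle : ⊢[ 4 ] (v₂ ⊕ v₀ ≐ v₃) ⇒ (S v₃ ⊕ v₁ ≐ v₂) ⇒ ⊥'
    cycle = derive (lam (lam (thm (S⊕≢ _ (v₁ ⊕ v₀)) ·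
      ≐-trans (≐-sym (thm (⊕-assoc (S _) v₁ v₀))) (≐-trans (⊕-congʳ v₀ h₀) h₁))))
    generic : ⊢[ 2 ] (S v₁ ≼ v₀) ⇒ ¬' (v₀ ≼ v₁)
    generic = ∃'-elim⇒ (derive (lam (lam (thm (∃'-elim⇒ cycle) · (thm (≼⇒∃ v₁ v₂) · h₀) · h₁))))
              ∘⇒ ≼⇒∃ (S v₁) v₀

  ≐⇒□≐ : ∀ {n} (a b : Tm n) → T ⊢ a ≐ b ⇒ □ (a ≐ b)
  ≐⇒□≐ a b = ⊢-subst (sub₂ a b) generic
    where
    generic : ⊢[ 2 ] v₀ ≐ v₁ ⇒ □ (v₀ ≐ v₁)
    generic = derive (lam (≐-subst (□ (v₁ ≐ v₀)) h₀ (thm (nec (ax-refl v₀)))))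

  ≼⇒□≼ : ∀ {n} (a b : Tm n) → T ⊢ (a ≼ b) ⇒ □ (a ≼ b)
  ≼⇒□≼ a b = ⊢-subst (sub₂ a b) generic
    where
    generic : ⊢[ 2 ] (v₀ ≼ v₁) ⇒ □ (v₀ ≼ v₁)
    generic = ∃'-elim⇒ (□-mono (≼-intro v₁ v₀ v₂) ∘⇒ ≐⇒□≐ (v₁ ⊕ v₀) v₂) ∘⇒ ≼⇒∃ v₀ v₁

  ≢⇒□≢ : ∀ {n} (a b : Tm n) → T ⊢ ¬' (a ≐ b) ⇒ □ (¬' (a ≐ b))
  ≢⇒□≢ a b = ⊢-subst (sub₂ a b) generic
    where
    a<b⇒a≢b : ⊢[ 2 ] (S v₀ ≼ v₁) ⇒ ¬' (v₀ ≐ v₁)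
    a<b⇒a≢b = derive (lam (lam (thm (<⇒≱ v₁ v₀) · h₁ · ≐-subst (v₀ ≼ v₁) h₀ (thm (≼-refl v₀)))))
    b<a⇒a≢b : ⊢[ 2 ] (S v₁ ≼ v₀) ⇒ ¬' (v₀ ≐ v₁)
    b<a⇒a≢b = derive (lam (lam (thm (<⇒≱ v₀ v₁) · h₁ · ≐-subst (v₁ ≼ v₀) h₀ (thm (≼-refl v₀)))))
    generic : ⊢[ 2 ] ¬' (v₀ ≐ v₁) ⇒ □ (¬' (v₀ ≐ v₁))
    generic = derive (lam (∨-elim (thm (≼-total v₀ v₁))
      (∨-elim (thm (≼⇒<∨≐ v₀ v₁) · h₀)
        (thm (□-mono a<b⇒a≢b) · (thm (≼⇒□≼ (S v₀) v₁) · h₀))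
        (contradiction h₂ h₀))
      (thm (□-mono b<a⇒a≢b) · (thm (≼⇒□≼ (S v₁) v₀) · h₀))))

  ≰⇒□≰ : ∀ {n} (a b : Tm n) → T ⊢ ¬' (a ≼ b) ⇒ □ (¬' (a ≼ b))
  ≰⇒□≰ a b = derive (lam (∨-elim (thm (≼-total a b))
    (contradiction h₁ h₀)
    (thm (□-mono (<⇒≱ a b)) · (thm (≼⇒□≼ (S b) a) · h₀))))

  -- Provable Σ₁(□)-completeness

  -- Induction on the bound: ∀x<0 is vacuous, and ∀x<S y splits into ∀x<y and the
  -- instance y, both of which are boxed and recombined under □ by K.
  ∀<□⇒□∀<-step : ∀ {m} (ψ : Fm (suc (suc m))) →
    T ⊢ (∀<' v₀ (□ ψ) ⇒ □ (∀<' v₀ ψ)) ⇒ (∀<' (S v₀) (□ ψ) ⇒ □ (∀<' (S v₀) ψ))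
  ∀<□⇒□∀<-step ψ =
    derive (lam (lam (thm (□-mono₂ recombine) · (h₁ · (thm restrict · h₀)) · (thm top · h₀))))
    where
    restrict : T ⊢ ∀<' (S v₀) (□ ψ) ⇒ ∀<' v₀ (□ ψ)
    restrict = ∀'-mono (derive (lam (lam (h₁ · (thm (≼-step (S v₀) v₁) · h₀)))))
    top : T ⊢ ∀<' (S v₀) (□ ψ) ⇒ □ (ψ [ v₀ ])
    top = derive (lam (∀'-inst v₀ h₀ · thm (≼-refl (S v₀))))
    wk-instance : renF (liftR suc) ψ [ v₁ ] ≡ wkF (ψ [ v₀ ])
    wk-instance = begin
      renF (liftR suc) ψ [ v₁ ]               ≡⟨ subF-renF _ (liftR suc) {ren⇒sub suc ∘ₛ single v₀}
                                                   (λ { zero → refl ; (suc i) → refl }) ψ ⟩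
      subF (ren⇒sub suc ∘ₛ single v₀) ψ        ≡⟨ sym (subF-∘ₛ (ren⇒sub suc) (single v₀) ψ) ⟩
      subF (ren⇒sub suc) (ψ [ v₀ ])            ≡⟨ sym (renF≡subF suc _) ⟩
      wkF (ψ [ v₀ ])                          ∎
      where open ≡-Reasoning
    instance-at-v₀ : T ⊢ v₁ ≐ v₀ ⇒ wkF (ψ [ v₀ ]) ⇒ ψ
    instance-at-v₀ = subst₂ (λ θ ξ → T ⊢ v₁ ≐ v₀ ⇒ θ ⇒ ξ) wk-instance (liftR-suc-[var₀] ψ)
                            (ax-leib (renF (liftR suc) ψ) v₁ v₀)
    recombine∧ : T ⊢ (∀<' v₀ ψ ∧' ψ [ v₀ ]) ⇒ ∀<' (S v₀) ψ
    recombine∧ = ∀'-intro⇒ (derive (lam (lam (∨-elim (thm (S≼S⇒<∨≐ v₀ v₁) · h₀)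
      (thm (∀'-elim⇒ ((v₀ <' v₁) ⇒ ψ)) · ∧-elimˡ h₂ · h₀)
      (thm instance-at-v₀ · ≐-sym h₀ · ∧-elimʳ h₂)))))
    recombine : T ⊢ ∀<' v₀ ψ ⇒ ψ [ v₀ ] ⇒ ∀<' (S v₀) ψ
    recombine = derive (lam (lam (thm recombine∧ · ∧-intro h₁ h₀)))

  ∀<□⇒□∀< : ∀ {n} (t : Tm n) (φ : Fm (suc n)) → T ⊢ ∀<' t (□ φ) ⇒ □ (∀<' t φ)
  ∀<□⇒□∀< {n} t φ = subst (λ θ → T ⊢ ∀<' t (□ θ) ⇒ □ (∀<' t θ)) instance-at-t
                          (mp (ax-inst χ t) (gen (induction χ base step)))
    where
    ψ : Fm (suc (suc n))
    ψ = renF (liftR suc) φ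
    χ : Fm (suc n)
    χ = ∀<' v₀ (□ ψ) ⇒ □ (∀<' v₀ ψ)
    instance-at-t : subF (liftS (single t)) ψ ≡ φ
    instance-at-t =
      trans (subF-renF _ (liftR suc) {var} (λ { zero → refl ; (suc i) → refl }) φ) (subF-var φ)
    ψ-ignores-bound : subF (liftS succ₀) ψ ≡ ψ
    ψ-ignores-bound =
      trans (subF-renF _ (liftR suc) {ren⇒sub (liftR suc)} (λ { zero → refl ; (suc i) → refl }) φ)
            (sym (renF≡subF (liftR suc) φ))
    base : T ⊢ χ [ 𝟎 ]
    base = mp (ax-K _ _) (nec (gen (derive (lam (contradiction (thm (S≰𝟎 v₀)) h₀)))))
    step : T ⊢ χ ⇒ subF succ₀ χ
    step = subst (λ θ → T ⊢ χ ⇒ (∀<' (S v₀) (□ θ) ⇒ □ (∀<' (S v₀) θ)))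
                 (sym ψ-ignores-bound) (∀<□⇒□∀<-step ψ)

  ∀<'-□ : ∀ {n} (t : Tm n) {φ : Fm (suc n)} → T ⊢ φ ⇒ □ φ → T ⊢ ∀<' t φ ⇒ □ (∀<' t φ)
  ∀<'-□ t {φ} d = ∀<□⇒□∀< t φ ∘⇒ ∀'-mono (derive (lam (lam (thm d · (h₁ · h₀)))))

  ∃'-□ : ∀ {n} {φ : Fm (suc n)} → T ⊢ φ ⇒ □ φ → T ⊢ ∃' φ ⇒ □ (∃' φ)
  ∃'-□ {φ = φ} d = ∃'-elim⇒ (□-mono (∃'-intro⇒ φ) ∘⇒ d)

  ∧-□ : ∀ {n} {φ ψ : Fm n} → T ⊢ φ ⇒ □ φ → T ⊢ ψ ⇒ □ ψ → T ⊢ φ ∧' ψ ⇒ □ (φ ∧' ψ)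
  ∧-□ dφ dψ = derive (lam (thm (□-mono₂ (derive (lam (lam (∧-intro h₁ h₀)))))
                           · (thm dφ · ∧-elimˡ h₀) · (thm dψ · ∧-elimʳ h₀)))

  ∨-□ : ∀ {n} {φ ψ : Fm n} → T ⊢ φ ⇒ □ φ → T ⊢ ψ ⇒ □ ψ → T ⊢ φ ∨' ψ ⇒ □ (φ ∨' ψ)
  ∨-□ dφ dψ = derive (lam (∨-elim h₀
    (thm (□-mono (derive (lam (∨-introˡ h₀)))) · (thm dφ · h₀))
    (thm (□-mono (derive (lam (∨-introʳ h₀)))) · (thm dψ · h₀))))

  -- A false Δ₀ formula is refuted inside □ as well, which the implication case needs.
  Δ₀⇒□ : ∀ {n} {φ : Fm n} → Δ₀ φ → T ⊢ φ ⇒ □ φ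
  ¬Δ₀⇒□¬ : ∀ {n} {φ : Fm n} → Δ₀ φ → T ⊢ ¬' φ ⇒ □ (¬' φ)

  Δ₀⇒□ (eq s t)   = ≐⇒□≐ s t
  Δ₀⇒□ (leq s t)  = ≼⇒□≼ s t
  Δ₀⇒□ bot        = derive (lam (⊥-elim h₀))
  Δ₀⇒□ (imp {φ = φ} {ψ} dφ dψ) = derive (lam (by-cases {φ = φ}
    (thm (□-mono (ax-K ψ φ)) · (thm (Δ₀⇒□ dψ) · (h₁ · h₀)))
    (thm (□-mono (derive (lam (lam (contradiction h₁ h₀))))) · (thm (¬Δ₀⇒□¬ dφ) · h₀))))
  Δ₀⇒□ (ball t d) = ∀<'-□ t (Δ₀⇒□ d)

  ¬Δ₀⇒□¬ (eq s t)  = ≢⇒□≢ s t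
  ¬Δ₀⇒□¬ (leq s t) = ≰⇒□≰ s t
  ¬Δ₀⇒□¬ bot       = derive (lam (thm (nec (⇒-refl ⊥'))))
  ¬Δ₀⇒□¬ (imp {φ = φ} {ψ} dφ dψ) = derive (lam (thm (□-mono₂ counterexample)
    · (thm (Δ₀⇒□ dφ) · by-contradiction (h₁ · lam (contradiction h₁ h₀)))
    · (thm (¬Δ₀⇒□¬ dψ) · lam (h₁ · lam h₁))))
    where
    counterexample : T ⊢ φ ⇒ ¬' ψ ⇒ ¬' (φ ⇒ ψ)
    counterexample = derive (lam (lam (lam (h₁ · (h₀ · h₂)))))
  ¬Δ₀⇒□¬ (ball t {φ} d) = ∃'-elim⇒ boxed-counterexample ∘⇒ ¬∀⇒∃¬
    where
    θ : Fm (suc _)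
    θ = (v₀ <' wkT t) ⇒ φ
    ¬∀⇒∃¬ : T ⊢ ¬' (∀' θ) ⇒ ∃' (¬' θ)
    ¬∀⇒∃¬ = derive (lam (lam (h₁ · (thm (∀'-mono (ax-DN θ)) · h₀))))
    counterexample : T ⊢ (v₀ <' wkT t) ⇒ ¬' φ ⇒ ¬' (wkF (∀' θ))
    counterexample = derive (lam (lam (lam (h₁ · (thm (∀'-elim⇒ θ) · h₀ · h₂)))))
    boxed-counterexample : T ⊢ ¬' θ ⇒ wkF (□ (¬' (∀' θ)))
    boxed-counterexample = derive (lam (thm (□-mono₂ counterexample)
      · (thm (≼⇒□≼ (S v₀) (wkT t)) · by-contradiction (h₁ · lam (contradiction h₁ h₀)))
      · (thm (¬Δ₀⇒□¬ d) · lam (h₁ · lam h₁))))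

  Σ₁⇒□ : ∀ {n} {φ : Fm n} → Σ₁ φ → T ⊢ φ ⇒ □ φ
  Σ₁⇒□ (delta d) = Δ₀⇒□ d
  Σ₁⇒□ (ex s)    = ∃'-□ (Σ₁⇒□ s)

  Σ₁□⇒□ : ∀ {n} {φ : Fm n} → Σ₁□ φ → T ⊢ φ ⇒ □ φ
  Σ₁□⇒□ (sigma s)  = Σ₁⇒□ s
  Σ₁□⇒□ (box φ)    = □-4 φ
  Σ₁□⇒□ (and p q)  = ∧-□ (Σ₁□⇒□ p) (Σ₁□⇒□ q)
  Σ₁□⇒□ (or p q)   = ∨-□ (Σ₁□⇒□ p) (Σ₁□⇒□ q)
  Σ₁□⇒□ (ex s)     = ∃'-□ (Σ₁□⇒□ s)
  Σ₁□⇒□ (ball t s) = ∀<'-□ t (Σ₁□⇒□ s)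

-- Eliminating the Σ₁(□) axioms

module Elimination (T X : Theory) (T⊇PAK4 : Extends-PAK4 T)
                   (X⊆Σ₁□ : ∀ {σ} → X σ → Σ₁□ σ) where
  open Derivations T
  open PA-K4-Reasoning T T⊇PAK4

  ⋀-++ˡ : ∀ {n} (φs ψs : List (Fm n)) → T ⊢ ⋀ (φs ++ ψs) ⇒ ⋀ φs
  ⋀-++ˡ []            ψs       = derive (lam (thm (⇒-refl ⊥')))
  ⋀-++ˡ (φ ∷ [])      []       = ⇒-refl φ
  ⋀-++ˡ (φ ∷ [])      (ψ ∷ ψs) = derive (lam (∧-elimˡ h₀))
  ⋀-++ˡ (φ ∷ φ′ ∷ φs) ψs       =
    derive (lam (∧-intro (∧-elimˡ h₀) (thm (⋀-++ˡ (φ′ ∷ φs) ψs) · ∧-elimʳ h₀)))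

  ⋀-++ʳ : ∀ {n} (φs ψs : List (Fm n)) → T ⊢ ⋀ (φs ++ ψs) ⇒ ⋀ ψs
  ⋀-++ʳ []            ψs       = ⇒-refl _
  ⋀-++ʳ (φ ∷ [])      []       = derive (lam (thm (⇒-refl ⊥')))
  ⋀-++ʳ (φ ∷ [])      (ψ ∷ ψs) = derive (lam (∧-elimʳ h₀))
  ⋀-++ʳ (φ ∷ φ′ ∷ φs) ψs       = derive (lam (thm (⋀-++ʳ (φ′ ∷ φs) ψs) · ∧-elimʳ h₀))

  ⋀⇒□⋀ : ∀ {n} (σs : List Sentence) → All X σs →
         T ⊢ ⋀ (map (weakenSentence {n}) σs) ⇒ □ (⋀ (map (weakenSentence {n}) σs))
  ⋀⇒□⋀ []           []       = mp (ax-K _ _) (nec (⇒-refl ⊥'))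
  ⋀⇒□⋀ (σ ∷ [])     (p ∷ []) = ⊢-rename (λ ()) (Σ₁□⇒□ (X⊆Σ₁□ p))
  ⋀⇒□⋀ (σ ∷ τ ∷ σs) (p ∷ ps) = ∧-□ (⊢-rename (λ ()) (Σ₁□⇒□ (X⊆Σ₁□ p))) (⋀⇒□⋀ (τ ∷ σs) ps)

  wkF-⋀ : ∀ {n} (σs : List Sentence) →
          wkF (⋀ (map (weakenSentence {n}) σs)) ≡ ⋀ (map (weakenSentence {suc n}) σs)
  wkF-⋀ []           = refl
  wkF-⋀ (σ ∷ [])     = renF-weakenSentence suc σ
  wkF-⋀ (σ ∷ τ ∷ σs) = cong₂ _∧'_ (renF-weakenSentence suc σ) (wkF-⋀ (τ ∷ σs))

  FromFinitelyManyOfX : ∀ {n} → Fm n → Set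
  FromFinitelyManyOfX φ =
    Σ (List Sentence) (λ σs → All X σs × (T ⊢ ⋀ (map weakenSentence σs) ⇒ φ))

  fromT : ∀ {n} {φ : Fm n} → T ⊢ φ → FromFinitelyManyOfX φ
  fromT d = [] , [] , mp (ax-K _ _) d

  eliminate : ∀ {n} {φ : Fm n} → (T +ₜ X) ⊢ φ → FromFinitelyManyOfX φ
  eliminate (ax (inj₁ p))         = fromT (ax p)
  eliminate (ax {σ = σ} (inj₂ p)) = σ ∷ [] , p ∷ [] , ⇒-refl _
  eliminate (ax-K φ ψ)            = fromT (ax-K φ ψ)
  eliminate (ax-S φ ψ χ)          = fromT (ax-S φ ψ χ)
  eliminate (ax-DN φ)             = fromT (ax-DN φ)
  eliminate (ax-inst φ t)         = fromT (ax-inst φ t)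
  eliminate (ax-gen ψ φ)          = fromT (ax-gen ψ φ)
  eliminate (ax-refl t)           = fromT (ax-refl t)
  eliminate (ax-leib φ s t)       = fromT (ax-leib φ s t)
  eliminate {n} (mp {φ = φ} {ψ} d e) with eliminate d | eliminate e
  ... | σs , σs∈X , ⋀σs⇒φ⇒ψ | τs , τs∈X , ⋀τs⇒φ =
    σs ++ τs , ++⁺ σs∈X τs∈X , subst (λ χs → T ⊢ ⋀ χs ⇒ ψ) (sym (map-++ weakenSentence σs τs)) joint
    where
    wσs wτs : List (Fm n)
    wσs = map weakenSentence σs
    wτs = map weakenSentence τs
    joint : T ⊢ ⋀ (wσs ++ wτs) ⇒ ψ
    joint = derive (lam (thm ⋀σs⇒φ⇒ψ · (thm (⋀-++ˡ wσs wτs) · h₀)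
                                    · (thm ⋀τs⇒φ · (thm (⋀-++ʳ wσs wτs) · h₀))))
  eliminate {n} (gen d) with eliminate d
  ... | σs , σs∈X , ⋀σs⇒φ =
    σs , σs∈X , ∀'-intro⇒ (subst (λ χ → T ⊢ χ ⇒ _) (sym (wkF-⋀ {n} σs)) ⋀σs⇒φ)
  eliminate (nec d) with eliminate d
  ... | σs , σs∈X , ⋀σs⇒φ = σs , σs∈X , □-mono ⋀σs⇒φ ∘⇒ ⋀⇒□⋀ σs σs∈X

corollary3p6 : (T X : Theory) → Extends-PAK4 T →
               (∀ {σ} → X σ → Σ₁□ σ) →
               ∀ {n} (φ : Fm n) → (T +ₜ X) ⊢ φ →
               Σ (List Sentence) (λ σs → All X σs ×
                 (T ⊢ ⋀ (map weakenSentence σs) ⇒ φ))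
corollary3p6 T X T⊇PAK4 X⊆Σ₁□ φ = Elimination.eliminate T X T⊇PAK4 X⊆Σ₁□
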